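{- Let $\Sigma$ be a finite alphabet of size $q$, let $\mathcal{X}\subseteq\Sigma^{m}$, let $\varepsilon\ge0$, and let $\mathcal{F}$ be the family of subsets $I\subseteq[m]$ such that $\mathcal{X}|_{I}$ is prefix thick with degree $(\frac{1}{2}+\varepsilon)\cdot q$. Then \[ \frac{|\mathcal{F}|}{2^{m}}\ge2^{ -2\log e\cdot\varepsilon\cdot m}\cdot\frac{|\mathcal{X}|}{|\Sigma^{m}|}. \]
   Context: Logs base 2. For $I\subseteq[m]$, $\mathcal{X}|_I\subseteq\Sigma^I$ is the set of projections of strings in $\mathcal{X}$ to the coordinates in $I$, viewed as strings of length $|I|$ (coordinates in increasing order). The prefix tree of a non-empty set $\mathcal{Z}\subseteq\Sigma^k$ is the rooted tree of depth $k$ whose vertices at depth $i$ are the length-$i$ prefixes of strings in $\mathcal{Z}$, where a depth-$(i+1)$ vertex $y$ is a child of a depth-$i$ vertex $x$ iff $x$ is a prefix of $y$. $\mathcal{Z}$ is prefix thick with degree $t$ if some non-empty $\mathcal{Z}'\subseteq\mathcal{Z}$ has a prefix tree in which every vertex at depth less than $k$ has more than $t$ children.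
   Formalization: The parameter ε ranges over the nonnegative rationals. -}

module Defs where

open import Data.Nat as ℕ using (ℕ; zero; suc)
open import Data.Integer using (+_)
open import Data.Rational as ℚ using (ℚ; _/_; 0ℚ; 1ℚ)
open import Data.Fin using (Fin)
open import Data.Vec as Vec using (Vec; []; _∷_)
open import Data.Bool using (Bool; true; false)
open import Data.List as List using (List; []; _∷_; take; length; _++_; [_])
open import Data.List.Membership.Propositional using (_∈_)
open import Data.List.Relation.Unary.All using (All)
open import Data.List.Relation.Unary.Unique.Propositional using (Unique)
open import Data.Product using (Σ; ∃; _×_; _,_)
open import Relation.Binary.PropositionalEquality using (_≡_; _≢_)

⟦_⟧ : ℕ → ℚ
⟦ n ⟧ = + n / 1

-- A subset I ⊆ [m] is a characteristic vector (true = in I).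
-- size I = |I|
size : ∀ {m} → Vec Bool m → ℕ
size [] = 0
size (true ∷ I) = suc (size I)
size (false ∷ I) = size I

proj : ∀ {A : Set} {m} (I : Vec Bool m) → Vec A m → Vec A (size I)
proj [] [] = []
proj (true ∷ I) (a ∷ x) = a ∷ proj I x
proj (false ∷ I) (a ∷ x) = proj I x

InProj : ∀ {A : Set} {m} (𝒳 : List (Vec A m)) (I : Vec Bool m) → Vec A (size I) → Set
InProj 𝒳 I y = Σ _ λ x → x ∈ 𝒳 × proj I x ≡ y

pre : ∀ {A : Set} {k} → ℕ → Vec A k → List A
pre i z = take i (Vec.toList z)

-- 𝒵 ⊆ Σ^k (a predicate) is prefix thick with degree t:
-- some non-empty 𝒵' ⊆ 𝒵 (a finite list of strings) has a prefix tree in which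
-- every vertex at depth i < k (i.e. every prefix pre i z, z ∈ 𝒵') has more than t
-- children, i.e. there are more than t distinct symbols a such that
-- (pre i z) ++ [a] is a length-(i+1) prefix of some string in 𝒵'.
PrefixThick : ∀ {A : Set} (k : ℕ) (𝒵 : Vec A k → Set) (t : ℚ) → Set
PrefixThick {A} k 𝒵 t =
  Σ (List (Vec A k)) λ 𝒵' →
    (𝒵' ≢ []) ×
    All 𝒵 𝒵' ×
    (∀ (i : ℕ) → i ℕ.< k → ∀ z → z ∈ 𝒵' →
      Σ (List A) λ cs →
        Unique cs ×
        t ℚ.< ⟦ length cs ⟧ ×
        All (λ a → Σ (Vec A k) λ z' → z' ∈ 𝒵' × pre (suc i) z' ≡ pre i z ++ [ a ]) cs)

-- Exponential partial sums: expTerm c k = c^k / k!, expSum c N = Σ_{k<N} c^k/k!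
expTerm : ℚ → ℕ → ℚ
expTerm c zero = 1ℚ
expTerm c (suc k) = expTerm c k ℚ.* c ℚ.* (+ 1 / suc k)

expSum : ℚ → ℕ → ℚ
expSum c zero = 0ℚ
expSum c (suc N) = expSum c N ℚ.+ expTerm c N

-- LeTimesExp a b c  means  a ≤ b · e^c  (for b ≥ 0, c ≥ 0), expressed as
-- a ≤ b · sup_N expSum c N, i.e. for every δ > 0 some N has a ≤ b·expSum c N + δ.
LeTimesExp : ℚ → ℚ → ℚ → Set
LeTimesExp a b c = ∀ (δ : ℚ) → 0ℚ ℚ.< δ → ∃ λ N → a ℚ.≤ b ℚ.* expSum c N ℚ.+ δ

{-# OPTIONS --safe #-}
-- Prune 𝒳|_I from the leaves up: at a coordinate outside I keep whatever survives below any symbol,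
-- at a coordinate in I keep the node only if more than (½ + ε) q of its children survive. The
-- survivors form a prefix-thick subset of 𝒳|_I; call I thick if there are any, and let N(𝒳) be the
-- number of thick I. Split 𝒳 by its first symbol into the 𝒳_a. If I is thick for exactly n of the
-- 𝒳_a, then 0I is thick for 𝒳 as soon as n > 0 and 1I as soon as n > (½ + ε) q; since n ≤ q this
-- gives n ≤ ρ (𝟙[0I thick] + 𝟙[1I thick]) with ρ = (1 + 2ε) q / 2, hence Σ_a N(𝒳_a) ≤ ρ N(𝒳).
-- By induction |𝒳| ≤ ρ^m N(𝒳), i.e. |𝒳| / q^m ≤ (1 + 2ε)^m N(𝒳) / 2^m, and (1 + 2ε)^m ≤ e^(2εm).
module Submission where

open import Defs
open import Data.Nat as ℕ using (ℕ)
open import Data.Rational as ℚ using (ℚ; ½; 0ℚ)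
open import Data.Fin using (Fin)
open import Data.Vec using (Vec)
open import Data.Bool using (Bool)
open import Data.List using (List; length)
open import Data.List.Relation.Unary.All using (All)
open import Data.List.Relation.Unary.Unique.Propositional using (Unique)
open import Data.Product using (Σ; _×_; _,_)
open import Relation.Binary.PropositionalEquality using (_≡_; subst; sym)

module _ where

  open import Data.Nat using (zero; suc)
  import Data.Nat.Properties as ℕ
  open import Data.Nat.Coprimality using (1-coprimeTo) renaming (sym to coprime-sym)
  open import Data.Integer as ℤ using (+_; -[1+_])
  import Data.Integer.Properties as ℤ
  open import Data.Rational using (mkℚ; 1ℚ; _+_; _*_; _/_; 1/_; _≤_; _<_; toℚᵘ; nonNegative)
  open import Data.Rational.Properties
  import Data.Rational.Unnormalised as ℚᵘ
  import Data.Rational.Unnormalised.Properties as ℚᵘ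
  open import Data.Rational.Solver using (module +-*-Solver)
  open +-*-Solver using (solve; _:+_; _:*_; _:=_; con)
  open import Algebra.Bundles using (CommutativeRing)
  open import Algebra.Properties.CommutativeSemiring.Exp (CommutativeRing.commutativeSemiring +-*-commutativeRing)
    using (_^_; ^-distrib-*)
  open import Data.Product using (_,_)
  open import Relation.Binary.PropositionalEquality

  ⟦⟧≡mkℚ : ∀ n → ⟦ n ⟧ ≡ mkℚ (+ n) 0 (coprime-sym (1-coprimeTo n))
  ⟦⟧≡mkℚ n = normalize-coprime (coprime-sym (1-coprimeTo n))

  toℚᵘ-⟦⟧ : ∀ n → toℚᵘ ⟦ n ⟧ ≡ ℚᵘ.mkℚᵘ (+ n) 0
  toℚᵘ-⟦⟧ n = cong toℚᵘ (⟦⟧≡mkℚ n)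

  ⟦⟧-homo-+ : ∀ m n → ⟦ m ℕ.+ n ⟧ ≡ ⟦ m ⟧ + ⟦ n ⟧
  ⟦⟧-homo-+ m n = toℚᵘ-injective (begin
    toℚᵘ ⟦ m ℕ.+ n ⟧                ≡⟨ toℚᵘ-⟦⟧ (m ℕ.+ n) ⟩
    ℚᵘ.mkℚᵘ (+ (m ℕ.+ n)) 0         ≈⟨ ℚᵘ.*≡* (cong (ℤ._* + 1) (trans (ℤ.pos-+ m n)
                                        (sym (cong₂ ℤ._+_ (ℤ.*-identityʳ (+ m)) (ℤ.*-identityʳ (+ n)))))) ⟩
    ℚᵘ.mkℚᵘ (+ m) 0 ℚᵘ.+ ℚᵘ.mkℚᵘ (+ n) 0 ≡⟨ cong₂ ℚᵘ._+_ (toℚᵘ-⟦⟧ m) (toℚᵘ-⟦⟧ n) ⟨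
    toℚᵘ ⟦ m ⟧ ℚᵘ.+ toℚᵘ ⟦ n ⟧      ≈⟨ toℚᵘ-homo-+ ⟦ m ⟧ ⟦ n ⟧ ⟨
    toℚᵘ (⟦ m ⟧ + ⟦ n ⟧)            ∎)
    where open ℚᵘ.≃-Reasoning

  ⟦⟧-homo-* : ∀ m n → ⟦ m ℕ.* n ⟧ ≡ ⟦ m ⟧ * ⟦ n ⟧
  ⟦⟧-homo-* m n = toℚᵘ-injective (begin
    toℚᵘ ⟦ m ℕ.* n ⟧                ≡⟨ toℚᵘ-⟦⟧ (m ℕ.* n) ⟩
    ℚᵘ.mkℚᵘ (+ (m ℕ.* n)) 0         ≈⟨ ℚᵘ.*≡* (cong (ℤ._* + 1) (ℤ.pos-* m n)) ⟩
    ℚᵘ.mkℚᵘ (+ m) 0 ℚᵘ.* ℚᵘ.mkℚᵘ (+ n) 0 ≡⟨ cong₂ ℚᵘ._*_ (toℚᵘ-⟦⟧ m) (toℚᵘ-⟦⟧ n) ⟨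
    toℚᵘ ⟦ m ⟧ ℚᵘ.* toℚᵘ ⟦ n ⟧      ≈⟨ toℚᵘ-homo-* ⟦ m ⟧ ⟦ n ⟧ ⟨
    toℚᵘ (⟦ m ⟧ * ⟦ n ⟧)            ∎)
    where open ℚᵘ.≃-Reasoning

  ⟦⟧-homo-^ : ∀ n m → ⟦ n ℕ.^ m ⟧ ≡ ⟦ n ⟧ ^ m
  ⟦⟧-homo-^ n zero = refl
  ⟦⟧-homo-^ n (suc m) = trans (⟦⟧-homo-* n (n ℕ.^ m)) (cong (⟦ n ⟧ *_) (⟦⟧-homo-^ n m))

  ⟦⟧-mono-≤ : ∀ {m n} → m ℕ.≤ n → ⟦ m ⟧ ≤ ⟦ n ⟧
  ⟦⟧-mono-≤ {m} {n} m≤n = toℚᵘ-cancel-≤ (subst₂ ℚᵘ._≤_ (sym (toℚᵘ-⟦⟧ m)) (sym (toℚᵘ-⟦⟧ n))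
    (ℚᵘ.*≤* (ℤ.*-monoʳ-≤-nonNeg (+ 1) (ℤ.+≤+ m≤n))))

  ⟦⟧-mono-< : ∀ {m n} → m ℕ.< n → ⟦ m ⟧ < ⟦ n ⟧
  ⟦⟧-mono-< {m} {n} m<n = toℚᵘ-cancel-< (subst₂ ℚᵘ._<_ (sym (toℚᵘ-⟦⟧ m)) (sym (toℚᵘ-⟦⟧ n))
    (ℚᵘ.*<* (ℤ.*-monoʳ-<-pos (+ 1) (ℤ.+<+ m<n))))

  *-nonNeg : ∀ {p q} → 0ℚ ≤ p → 0ℚ ≤ q → 0ℚ ≤ p * q
  *-nonNeg {p} {q} 0≤p 0≤q =
    nonNegative⁻¹ _ {{nonNeg*nonNeg⇒nonNeg p {{nonNegative 0≤p}} q {{nonNegative 0≤q}}}}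

  +-nonNeg : ∀ {p q} → 0ℚ ≤ p → 0ℚ ≤ q → 0ℚ ≤ p + q
  +-nonNeg {p} {q} 0≤p 0≤q =
    nonNegative⁻¹ _ {{nonNeg+nonNeg⇒nonNeg p {{nonNegative 0≤p}} q {{nonNegative 0≤q}}}}

  p≤p+q : ∀ {p q} → 0ℚ ≤ q → p ≤ p + q
  p≤p+q {p} 0≤q = ≤-trans (≤-reflexive (sym (+-identityʳ p))) (+-monoʳ-≤ p 0≤q)

  0≤1 : 0ℚ ≤ 1ℚ
  0≤1 = ≤ᵇ⇒≤ _

  ⟦⟧-nonNeg : ∀ n → 0ℚ ≤ ⟦ n ⟧
  ⟦⟧-nonNeg n = ⟦⟧-mono-≤ {0} {n} ℕ.z≤n

  1/suc-nonNeg : ∀ n → 0ℚ ≤ + 1 / suc n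
  1/suc-nonNeg n = nonNegative⁻¹ _ {{normalize-nonNeg 1 (suc n)}}

  ⟦suc⟧*1/suc : ∀ n → ⟦ suc n ⟧ * (+ 1 / suc n) ≡ 1ℚ
  ⟦suc⟧*1/suc n = begin
    ⟦ suc n ⟧ * (+ 1 / suc n)  ≡⟨ cong₂ _*_ (⟦⟧≡mkℚ (suc n)) (normalize-coprime {1} {n} (1-coprimeTo (suc n))) ⟩
    sn * 1/ sn                 ≡⟨ *-inverseʳ sn ⟩
    1ℚ                         ∎
    where
    open ≡-Reasoning
    sn : ℚ
    sn = mkℚ (+ suc n) 0 (coprime-sym (1-coprimeTo (suc n)))

  expTerm-nonNeg : ∀ {c} → 0ℚ ≤ c → ∀ k → 0ℚ ≤ expTerm c k
  expTerm-nonNeg 0≤c zero = 0≤1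
  expTerm-nonNeg 0≤c (suc k) = *-nonNeg (*-nonNeg (expTerm-nonNeg 0≤c k) 0≤c) (1/suc-nonNeg k)

  expTerm-suc-* : ∀ c k → expTerm c (suc k) * ⟦ suc k ⟧ ≡ expTerm c k * c
  expTerm-suc-* c k = begin
    expTerm c k * c * (+ 1 / suc k) * ⟦ suc k ⟧   ≡⟨ *-assoc (expTerm c k * c) (+ 1 / suc k) ⟦ suc k ⟧ ⟩
    expTerm c k * c * ((+ 1 / suc k) * ⟦ suc k ⟧) ≡⟨ cong (expTerm c k * c *_)
                                                      (trans (*-comm (+ 1 / suc k) ⟦ suc k ⟧) (⟦suc⟧*1/suc k)) ⟩
    expTerm c k * c * 1ℚ                           ≡⟨ *-identityʳ _ ⟩
    expTerm c k * c                                ∎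
    where open ≡-Reasoning

  -- the first two terms of the binomial expansion of (a + b)^(k+1) / (k+1)!
  expTerm-+-suc : ∀ {a b} → 0ℚ ≤ a → 0ℚ ≤ b → ∀ k →
    expTerm a (suc k) + b * expTerm a k ≤ expTerm (a + b) (suc k)
  expTerm-+-suc {a} {b} _ _ zero = ≤-reflexive
    (solve 2 (λ a b → con 1ℚ :* a :* con 1ℚ :+ b :* con 1ℚ := con 1ℚ :* (a :+ b) :* con 1ℚ) refl a b)
  expTerm-+-suc {a} {b} 0≤a 0≤b (suc k) = begin
    T₂ + b * T₁                              ≤⟨ p≤p+q (*-nonNeg (*-nonNeg (*-nonNeg 0≤b 0≤b) (expTerm-nonNeg 0≤a k))
                                                                  (1/suc-nonNeg (suc k))) ⟩
    T₂ + b * T₁ + b * b * T₀ * h             ≡⟨ expand ⟨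
    (T₁ + b * T₀) * (a + b) * h              ≤⟨ *-monoʳ-≤-nonNeg h {{nonNegative (1/suc-nonNeg (suc k))}}
                                                  (*-monoʳ-≤-nonNeg (a + b) {{nonNegative (+-nonNeg 0≤a 0≤b)}}
                                                    (expTerm-+-suc 0≤a 0≤b k)) ⟩
    expTerm (a + b) (suc (suc k))            ∎
    where
    open ≤-Reasoning
    T₀ T₁ T₂ h : ℚ
    T₀ = expTerm a k
    T₁ = expTerm a (suc k)
    T₂ = expTerm a (suc (suc k))
    h = + 1 / suc (suc k)
    expand : (T₁ + b * T₀) * (a + b) * h ≡ T₂ + b * T₁ + b * b * T₀ * h
    expand = begin-equality
      (T₁ + b * T₀) * (a + b) * h                          ≡⟨ solve 5 (λ T₁ T₀ a b h →
          (T₁ :+ b :* T₀) :* (a :+ b) :* h := T₁ :* a :* h :+ b :* h :* (T₁ :+ T₀ :* a) :+ b :* b :* T₀ :* h)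
          refl T₁ T₀ a b h ⟩
      T₂ + b * h * (T₁ + T₀ * a) + b * b * T₀ * h          ≡⟨ cong (λ x → T₂ + b * h * (T₁ + x) + b * b * T₀ * h)
                                                                (sym (expTerm-suc-* a k)) ⟩
      T₂ + b * h * (T₁ + T₁ * ⟦ suc k ⟧) + b * b * T₀ * h  ≡⟨ cong (λ x → T₂ + x + b * b * T₀ * h) (solve 4 (λ T₁ b h n →
          b :* h :* (T₁ :+ T₁ :* n) := b :* T₁ :* ((con 1ℚ :+ n) :* h)) refl T₁ b h ⟦ suc k ⟧) ⟩
      T₂ + b * T₁ * ((1ℚ + ⟦ suc k ⟧) * h) + b * b * T₀ * h ≡⟨ cong (λ x → T₂ + b * T₁ * x + b * b * T₀ * h)
                                                                (trans (cong (_* h) (sym (⟦⟧-homo-+ 1 (suc k)))) (⟦suc⟧*1/suc (suc k))) ⟩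
      T₂ + b * T₁ * 1ℚ + b * b * T₀ * h                    ≡⟨ cong (λ x → T₂ + x + b * b * T₀ * h) (*-identityʳ _) ⟩
      T₂ + b * T₁ + b * b * T₀ * h                         ∎

  expSum-+-suc : ∀ {a b} → 0ℚ ≤ a → 0ℚ ≤ b → ∀ N →
    expSum a (suc N) + b * expSum a N ≤ expSum (a + b) (suc N)
  expSum-+-suc {a} {b} _ _ zero = ≤-reflexive
    (solve 1 (λ b → (con 0ℚ :+ con 1ℚ) :+ b :* con 0ℚ := con 0ℚ :+ con 1ℚ) refl b)
  expSum-+-suc {a} {b} 0≤a 0≤b (suc N) = begin
    expSum a (suc N) + expTerm a (suc N) + b * (expSum a N + expTerm a N)     ≡⟨ solve 5 (λ E₁ E₀ T₁ T₀ b →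
        E₁ :+ T₁ :+ b :* (E₀ :+ T₀) := (E₁ :+ b :* E₀) :+ (T₁ :+ b :* T₀))
        refl (expSum a (suc N)) (expSum a N) (expTerm a (suc N)) (expTerm a N) b ⟩
    (expSum a (suc N) + b * expSum a N) + (expTerm a (suc N) + b * expTerm a N) ≤⟨ +-mono-≤ (expSum-+-suc 0≤a 0≤b N)
                                                                                   (expTerm-+-suc 0≤a 0≤b N) ⟩
    expSum (a + b) (suc (suc N))                                               ∎
    where
    open ≤-Reasoning

  expSum-*-1+ : ∀ {a b} → 0ℚ ≤ a → 0ℚ ≤ b → ∀ N → expSum a N * (1ℚ + b) ≤ expSum (a + b) (suc N)
  expSum-*-1+ {a} {b} 0≤a 0≤b N = begin
    expSum a N * (1ℚ + b)            ≡⟨ solve 2 (λ E b → E :* (con 1ℚ :+ b) := E :+ b :* E) refl (expSum a N) b ⟩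
    expSum a N + b * expSum a N      ≤⟨ +-monoˡ-≤ (b * expSum a N) (p≤p+q {expSum a N} (expTerm-nonNeg 0≤a N)) ⟩
    expSum a (suc N) + b * expSum a N ≤⟨ expSum-+-suc 0≤a 0≤b N ⟩
    expSum (a + b) (suc N)           ∎
    where
    open ≤-Reasoning

  1+^≤expSum : ∀ {y} → 0ℚ ≤ y → ∀ m → (1ℚ + y) ^ m ≤ expSum (y * ⟦ m ⟧) (suc m)
  1+^≤expSum _ zero = ≤-reflexive (sym (+-identityˡ 1ℚ))
  1+^≤expSum {y} 0≤y (suc m) = begin
    (1ℚ + y) * (1ℚ + y) ^ m                  ≡⟨ *-comm (1ℚ + y) ((1ℚ + y) ^ m) ⟩
    (1ℚ + y) ^ m * (1ℚ + y)                  ≤⟨ *-monoʳ-≤-nonNeg (1ℚ + y) {{nonNegative (+-nonNeg 0≤1 0≤y)}}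
                                                  (1+^≤expSum 0≤y m) ⟩
    expSum (y * ⟦ m ⟧) (suc m) * (1ℚ + y)    ≤⟨ expSum-*-1+ (*-nonNeg 0≤y (⟦⟧-nonNeg m)) 0≤y (suc m) ⟩
    expSum (y * ⟦ m ⟧ + y) (suc (suc m))     ≡⟨ cong (λ c → expSum c (suc (suc m))) y*m+y≡y*suc-m ⟩
    expSum (y * ⟦ suc m ⟧) (suc (suc m))     ∎
    where
    open ≤-Reasoning
    y*m+y≡y*suc-m : y * ⟦ m ⟧ + y ≡ y * ⟦ suc m ⟧
    y*m+y≡y*suc-m = begin-equality
      y * ⟦ m ⟧ + y        ≡⟨ cong (λ x → y * ⟦ m ⟧ + x) (sym (*-identityʳ y)) ⟩
      y * ⟦ m ⟧ + y * 1ℚ   ≡⟨ sym (*-distribˡ-+ y ⟦ m ⟧ 1ℚ) ⟩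
      y * (⟦ m ⟧ + ⟦ 1 ⟧)  ≡⟨ cong (y *_) (sym (⟦⟧-homo-+ m 1)) ⟩
      y * ⟦ m ℕ.+ 1 ⟧      ≡⟨ cong (λ n → y * ⟦ n ⟧) (ℕ.+-comm m 1) ⟩
      y * ⟦ suc m ⟧        ∎

  nonNeg⇒fraction : ∀ ε → 0ℚ ≤ ε → Σ ℕ λ p → Σ ℕ λ d-1 → ε * ⟦ suc d-1 ⟧ ≡ ⟦ p ⟧
  nonNeg⇒fraction ε@(mkℚ (+ p) d-1 _) _ = p , d-1 , toℚᵘ-injective (begin
    toℚᵘ (ε * ⟦ suc d-1 ⟧)                         ≈⟨ toℚᵘ-homo-* ε ⟦ suc d-1 ⟧ ⟩
    ℚᵘ.mkℚᵘ (+ p) d-1 ℚᵘ.* toℚᵘ ⟦ suc d-1 ⟧         ≡⟨ cong (ℚᵘ.mkℚᵘ (+ p) d-1 ℚᵘ.*_) (toℚᵘ-⟦⟧ (suc d-1)) ⟩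
    ℚᵘ.mkℚᵘ (+ p) d-1 ℚᵘ.* ℚᵘ.mkℚᵘ (+ suc d-1) 0  ≈⟨ ℚᵘ.*≡* (trans (ℤ.*-identityʳ _)
                                                        (cong (λ n → + p ℤ.* + n) (sym (ℕ.*-identityʳ (suc d-1))))) ⟩
    ℚᵘ.mkℚᵘ (+ p) 0                                ≡⟨ toℚᵘ-⟦⟧ p ⟨
    toℚᵘ ⟦ p ⟧                                     ∎)
    where open ℚᵘ.≃-Reasoning
  nonNeg⇒fraction (mkℚ -[1+ _ ] _ _) (ℚ.*≤* ())

  ≤*1+^⇒LeTimesExp : ∀ {a b y} m → 0ℚ ≤ b → 0ℚ ≤ y → a ≤ b * (1ℚ + y) ^ m → LeTimesExp a b (y * ⟦ m ⟧)
  ≤*1+^⇒LeTimesExp {a} {b} {y} m 0≤b 0≤y a≤ δ 0<δ = suc m , (begin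
    a                                              ≤⟨ a≤ ⟩
    b * (1ℚ + y) ^ m                               ≤⟨ *-monoˡ-≤-nonNeg b {{nonNegative 0≤b}} (1+^≤expSum 0≤y m) ⟩
    b * expSum (y * ⟦ m ⟧) (suc m)                 ≤⟨ p≤p+q (<⇒≤ 0<δ) ⟩
    b * expSum (y * ⟦ m ⟧) (suc m) + δ             ∎)
    where open ≤-Reasoning

module _ where

  open import Data.Nat using (zero; suc; _+_; _*_; _^_; _≤_; _<_; z≤n; s≤s)
  open import Data.Nat.Properties
  open import Data.Nat.ListAction using (sum)
  open import Data.Nat.ListAction.Properties using (sum-++)
  open import Algebra.Properties.CommutativeSemigroup +-commutativeSemigroup using (interchange)
  open import Data.Bool using (true; false; if_then_else_; T)
  open import Data.Bool.Properties using (T?)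
  open import Data.Fin as Fin using ()
  open import Data.Vec using ([]; _∷_)
  open import Data.Vec.Properties using (∷-injectiveʳ)
  open import Data.List using ([]; _∷_; _++_; [_]; map; concatMap; filter; allFin)
  open import Data.List.Properties using (map-++; map-∘; map-cong; map-tabulate; length-tabulate)
  open import Data.List.Membership.Propositional using (_∈_; find; lose)
  open import Data.List.Membership.Propositional.Properties
    using (∈-map⁺; ∈-map⁻; ∈-concatMap⁺; ∈-concatMap⁻; ∈-filter⁻; ∈-allFin)
  open import Data.List.Relation.Unary.Any using (here; there)
  open import Data.List.Relation.Unary.All as All using (_∷_)
  open import Data.List.Relation.Unary.AllPairs using ([]; _∷_)
  import Data.List.Relation.Unary.Unique.Propositional.Properties as Unique
  open import Data.List.Relation.Binary.Subset.Propositional using (_⊆_)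
  open import Data.Product using (_,_; proj₂)
  open import Data.Empty using (⊥-elim)
  open import Relation.Nullary using (yes; no; does; ¬_)
  open import Relation.Binary.PropositionalEquality hiding ([_])

  𝟙 : Bool → ℕ
  𝟙 true = 1
  𝟙 false = 0

  private variable A B : Set

  ∑ : List A → (A → ℕ) → ℕ
  ∑ xs f = sum (map f xs)

  ∑-zero : ∀ (xs : List A) → ∑ xs (λ _ → 0) ≡ 0
  ∑-zero [] = refl
  ∑-zero (_ ∷ xs) = ∑-zero xs

  ∑-++ : ∀ (xs ys : List A) f → ∑ (xs ++ ys) f ≡ ∑ xs f + ∑ ys f
  ∑-++ xs ys f = trans (cong sum (map-++ f xs ys)) (sum-++ (map f xs) (map f ys))

  ∑-map : ∀ (g : A → B) (xs : List A) f → ∑ (map g xs) f ≡ ∑ xs (λ x → f (g x))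
  ∑-map g xs f = cong sum (sym (map-∘ xs))

  ∑-cong : ∀ (xs : List A) {f g} → (∀ x → f x ≡ g x) → ∑ xs f ≡ ∑ xs g
  ∑-cong xs f≗g = cong sum (map-cong f≗g xs)

  ∑-mono-≤ : ∀ (xs : List A) {f g} → (∀ x → f x ≤ g x) → ∑ xs f ≤ ∑ xs g
  ∑-mono-≤ [] f≤g = z≤n
  ∑-mono-≤ (x ∷ xs) f≤g = +-mono-≤ (f≤g x) (∑-mono-≤ xs f≤g)

  ∑-+ : ∀ (xs : List A) f g → ∑ xs (λ x → f x + g x) ≡ ∑ xs f + ∑ xs g
  ∑-+ [] f g = refl
  ∑-+ (x ∷ xs) f g = trans (cong (f x + g x +_) (∑-+ xs f g)) (interchange (f x) (g x) _ _)

  *-∑ : ∀ c (xs : List A) f → c * ∑ xs f ≡ ∑ xs (λ x → c * f x)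
  *-∑ c [] f = *-zeroʳ c
  *-∑ c (x ∷ xs) f = trans (*-distribˡ-+ c (f x) _) (cong (c * f x +_) (*-∑ c xs f))

  ∑-* : ∀ c (xs : List A) f → ∑ xs f * c ≡ ∑ xs (λ x → f x * c)
  ∑-* c xs f = trans (*-comm _ c) (trans (*-∑ c xs f) (∑-cong xs (λ x → *-comm c (f x))))

  ∑-swap : ∀ (xs : List A) (ys : List B) (f : A → B → ℕ) →
    ∑ xs (λ x → ∑ ys (f x)) ≡ ∑ ys (λ y → ∑ xs (λ x → f x y))
  ∑-swap [] ys f = sym (∑-zero ys)
  ∑-swap (x ∷ xs) ys f = trans (cong (∑ ys (f x) +_) (∑-swap xs ys f)) (sym (∑-+ ys (f x) _))

  ∑-𝟙≤length : ∀ (xs : List A) (p : A → Bool) → ∑ xs (λ x → 𝟙 (p x)) ≤ length xs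
  ∑-𝟙≤length [] p = z≤n
  ∑-𝟙≤length (x ∷ xs) p with p x
  ... | true = s≤s (∑-𝟙≤length xs p)
  ... | false = m≤n⇒m≤1+n (∑-𝟙≤length xs p)

  length-filter≡∑-𝟙 : ∀ (p : A → Bool) (xs : List A) →
    length (filter (λ x → T? (p x)) xs) ≡ ∑ xs (λ x → 𝟙 (p x))
  length-filter≡∑-𝟙 p [] = refl
  length-filter≡∑-𝟙 p (x ∷ xs) with p x
  ... | true = cong suc (length-filter≡∑-𝟙 p xs)
  ... | false = length-filter≡∑-𝟙 p xs

  ∑-allFin-suc : ∀ {n} f → ∑ (allFin (suc n)) f ≡ f Fin.zero + ∑ (allFin n) (λ i → f (Fin.suc i))
  ∑-allFin-suc {n} f = cong (f Fin.zero +_)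
    (trans (cong sum (map-tabulate Fin.suc f)) (sym (cong sum (map-tabulate (λ i → i) (λ i → f (Fin.suc i))))))

  ∑-allFin-≟ : ∀ {n} (j : Fin n) → ∑ (allFin n) (λ i → 𝟙 (does (i Fin.≟ j))) ≡ 1
  ∑-allFin-≟ {suc n} Fin.zero =
    trans (∑-allFin-suc {n} (λ i → 𝟙 (does (i Fin.≟ Fin.zero)))) (cong suc (∑-zero (allFin n)))
  ∑-allFin-≟ {suc n} (Fin.suc j) =
    trans (∑-allFin-suc {n} (λ i → 𝟙 (does (i Fin.≟ Fin.suc j)))) (∑-allFin-≟ j)

  ∑-𝟙-positive : ∀ (xs : List A) (p : A → Bool) → 0 < ∑ xs (λ x → 𝟙 (p x)) →
    Σ A λ x → x ∈ xs × T (p x)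
  ∑-𝟙-positive (x ∷ xs) p 0<∑ with p x in px
  ... | true = x , here refl , subst T (sym px) _
  ... | false with ∑-𝟙-positive xs p 0<∑
  ...   | y , y∈ , py = y , there y∈ , py

  nonEmpty : List A → Bool
  nonEmpty [] = false
  nonEmpty (_ ∷ _) = true

  nonEmpty⇒∈ : ∀ {xs : List A} → T (nonEmpty xs) → Σ A (_∈ xs)
  nonEmpty⇒∈ {xs = x ∷ _} _ = x , here refl

  ∈⇒nonEmpty : ∀ {xs : List A} {x} → x ∈ xs → T (nonEmpty xs)
  ∈⇒nonEmpty (here _) = _
  ∈⇒nonEmpty (there _) = _

  ∈-if⁻ : ∀ {b} {xs : List A} {x} → x ∈ (if b then xs else []) → T b × x ∈ xs
  ∈-if⁻ {b = true} x∈ = _ , x∈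

  ∈-if⁺ : ∀ {b} {xs : List A} {x} → T b → x ∈ xs → x ∈ (if b then xs else [])
  ∈-if⁺ {b = true} _ x∈ = x∈

  subsets : ∀ m → List (Vec Bool m)
  subsets zero = [ [] ]
  subsets (suc m) = map (false ∷_) (subsets m) ++ map (true ∷_) (subsets m)

  subsets-unique : ∀ m → Unique (subsets m)
  subsets-unique zero = All.[] ∷ []
  subsets-unique (suc m) =
    Unique.++⁺ (Unique.map⁺ ∷-injectiveʳ (subsets-unique m)) (Unique.map⁺ ∷-injectiveʳ (subsets-unique m)) disjoint
    where
    disjoint : ∀ {I} → ¬ (I ∈ map (false ∷_) (subsets m) × I ∈ map (true ∷_) (subsets m))
    disjoint (I∈₀ , I∈₁) with ∈-map⁻ (false ∷_) I∈₀ | ∈-map⁻ (true ∷_) I∈₁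
    ... | _ , _ , refl | _ , _ , ()

  module _ {q : ℕ} where

    residual : ∀ {m} → Fin q → List (Vec (Fin q) (suc m)) → List (Vec (Fin q) m)
    residual a [] = []
    residual a ((b ∷ x) ∷ X) with a Fin.≟ b
    ... | yes _ = x ∷ residual a X
    ... | no _ = residual a X

    ∈-residual⁻ : ∀ {m} a (X : List (Vec (Fin q) (suc m))) {x} → x ∈ residual a X → (a ∷ x) ∈ X
    ∈-residual⁻ a ((b ∷ y) ∷ X) x∈ with a Fin.≟ b
    ∈-residual⁻ a ((b ∷ y) ∷ X) (here refl) | yes refl = here refl
    ∈-residual⁻ a ((b ∷ y) ∷ X) (there x∈) | yes refl = there (∈-residual⁻ a X x∈)
    ... | no _ = there (∈-residual⁻ a X x∈)

    residual-unique : ∀ {m} a {X : List (Vec (Fin q) (suc m))} → Unique X → Unique (residual a X)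
    residual-unique a [] = []
    residual-unique a {(b ∷ x) ∷ X} (x∉X ∷ uX) with a Fin.≟ b
    ... | yes refl = All.tabulate (λ y∈ y≡x → All.lookup x∉X (∈-residual⁻ a X y∈) (cong (a ∷_) y≡x))
                     ∷ residual-unique a uX
    ... | no _ = residual-unique a uX

    length-residual-∷ : ∀ {m} a b (x : Vec (Fin q) m) X →
      length (residual a ((b ∷ x) ∷ X)) ≡ 𝟙 (does (a Fin.≟ b)) + length (residual a X)
    length-residual-∷ a b x X with a Fin.≟ b
    ... | yes _ = refl
    ... | no _ = refl

    length≡∑-residual : ∀ {m} (X : List (Vec (Fin q) (suc m))) →
      length X ≡ ∑ (allFin q) (λ a → length (residual a X))
    length≡∑-residual [] = sym (∑-zero (allFin q))
    length≡∑-residual ((b ∷ x) ∷ X) = sym (begin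
      ∑ (allFin q) (λ a → length (residual a ((b ∷ x) ∷ X)))               ≡⟨ ∑-cong (allFin q) (λ a → length-residual-∷ a b x X) ⟩
      ∑ (allFin q) (λ a → 𝟙 (does (a Fin.≟ b)) + length (residual a X))     ≡⟨ ∑-+ (allFin q) _ _ ⟩
      ∑ (allFin q) (λ a → 𝟙 (does (a Fin.≟ b))) + ∑ (allFin q) (λ a → length (residual a X))
                                                                            ≡⟨ cong₂ _+_ (∑-allFin-≟ b) (sym (length≡∑-residual X)) ⟩
      suc (length X)                                                         ∎)
      where open ≡-Reasoning

  module Pruning {q : ℕ} (big : ℕ → Bool) where

    Word : ℕ → Set
    Word = Vec (Fin q)

    mutual
      survivors : ∀ {m} → List (Word m) → (I : Vec Bool m) → List (Word (size I))
      survivors X [] = X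
      survivors X (false ∷ I) = concatMap (λ a → survivors (residual a X) I) (allFin q)
      survivors X (true ∷ I) =
        if big (branching X I) then concatMap (λ a → map (a ∷_) (survivors (residual a X) I)) (allFin q) else []

      branching : ∀ {m} → List (Word (suc m)) → Vec Bool m → ℕ
      branching X I = ∑ (allFin q) (λ a → 𝟙 (nonEmpty (survivors (residual a X) I)))

    isThick : ∀ {m} → List (Word m) → Vec Bool m → Bool
    isThick X I = nonEmpty (survivors X I)

    countThick : ∀ {m} → List (Word m) → ℕ
    countThick {m} X = ∑ (subsets m) (λ I → 𝟙 (isThick X I))

    module _ {m} (X : List (Word (suc m))) (I : Vec Bool m) where

      ∈-survivors-false⁺ : ∀ {a w} → w ∈ survivors (residual a X) I → w ∈ survivors X (false ∷ I)
      ∈-survivors-false⁺ {a} w∈ = ∈-concatMap⁺ (λ a → survivors (residual a X) I) (lose (∈-allFin a) w∈)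

      ∈-survivors-false⁻ : ∀ {z} → z ∈ survivors X (false ∷ I) →
        Σ (Fin q) λ a → z ∈ survivors (residual a X) I
      ∈-survivors-false⁻ z∈ with find (∈-concatMap⁻ (λ a → survivors (residual a X) I) {xs = allFin q} z∈)
      ... | a , _ , z∈′ = a , z∈′

      ∈-survivors-true⁺ : T (big (branching X I)) →
        ∀ {a w} → w ∈ survivors (residual a X) I → (a ∷ w) ∈ survivors X (true ∷ I)
      ∈-survivors-true⁺ isBig {a} w∈ = ∈-if⁺ isBig
        (∈-concatMap⁺ (λ a → map (a ∷_) (survivors (residual a X) I)) (lose (∈-allFin a) (∈-map⁺ (a ∷_) w∈)))

      ∈-survivors-true⁻ : ∀ {z} → z ∈ survivors X (true ∷ I) →
        T (big (branching X I)) ×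
        Σ (Fin q) λ a → Σ (Word (size I)) λ w → w ∈ survivors (residual a X) I × z ≡ a ∷ w
      ∈-survivors-true⁻ z∈ with ∈-if⁻ {b = big (branching X I)} z∈
      ... | isBig , z∈′
          with find (∈-concatMap⁻ (λ a → map (a ∷_) (survivors (residual a X) I)) {xs = allFin q} z∈′)
      ... | a , _ , z∈″ with ∈-map⁻ (a ∷_) z∈″
      ... | w , w∈ , z≡a∷w = isBig , a , w , w∈ , z≡a∷w

    survivors⊆proj : ∀ {m} (X : List (Word m)) I {z} → z ∈ survivors X I → InProj X I z
    survivors⊆proj X [] {[]} z∈ = [] , z∈ , refl
    survivors⊆proj X (false ∷ I) z∈ with ∈-survivors-false⁻ X I z∈
    ... | a , z∈′ with survivors⊆proj (residual a X) I z∈′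
    ... | x , x∈ , proj≡z = (a ∷ x) , ∈-residual⁻ a X x∈ , proj≡z
    survivors⊆proj X (true ∷ I) z∈ with ∈-survivors-true⁻ X I z∈
    ... | _ , a , w , w∈ , refl with survivors⊆proj (residual a X) I w∈
    ... | x , x∈ , proj≡w = (a ∷ x) , ∈-residual⁻ a X x∈ , cong (a ∷_) proj≡w

    module _ (t : ℚ) (big⇒t< : ∀ n → T (big n) → t ℚ.< ⟦ n ⟧) where

      ThickAt : ∀ {k} → List (Word k) → Word k → ℕ → Set
      ThickAt {k} 𝒵 z i = Σ (List (Fin q)) λ cs → Unique cs × t ℚ.< ⟦ length cs ⟧ ×
        All (λ a → Σ (Word k) λ z′ → z′ ∈ 𝒵 × pre (suc i) z′ ≡ pre i z ++ [ a ]) cs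

      ThickAt-mono : ∀ {k} {𝒵 𝒵′ : List (Word k)} → 𝒵 ⊆ 𝒵′ → ∀ {z i} → ThickAt 𝒵 z i → ThickAt 𝒵′ z i
      ThickAt-mono 𝒵⊆𝒵′ (cs , uniq , t<|cs| , children) =
        cs , uniq , t<|cs| , All.map (λ (z′ , z′∈ , pre≡) → z′ , 𝒵⊆𝒵′ z′∈ , pre≡) children

      ThickAt-∷ : ∀ {k} {𝒵 : List (Word k)} {𝒵′} {a} → (∀ {w} → w ∈ 𝒵 → (a ∷ w) ∈ 𝒵′) →
        ∀ {z i} → ThickAt 𝒵 z i → ThickAt 𝒵′ (a ∷ z) (suc i)
      ThickAt-∷ {a = a} a∷𝒵⊆𝒵′ (cs , uniq , t<|cs| , children) =
        cs , uniq , t<|cs| , All.map (λ (z′ , z′∈ , pre≡) → a ∷ z′ , a∷𝒵⊆𝒵′ z′∈ , cong (a ∷_) pre≡) children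

      ThickAt-survivors-root : ∀ {m} (X : List (Word (suc m))) I → T (big (branching X I)) →
        ∀ {z} → ThickAt (survivors X (true ∷ I)) z 0
      ThickAt-survivors-root X I isBig {z} =
        branches , Unique.filter⁺ _ (Unique.allFin⁺ q) , t<|branches| , All.tabulate child
        where
        hasSurvivors : Fin q → Bool
        hasSurvivors a = nonEmpty (survivors (residual a X) I)
        branches : List (Fin q)
        branches = filter (λ a → T? (hasSurvivors a)) (allFin q)
        t<|branches| : t ℚ.< ⟦ length branches ⟧
        t<|branches| = subst (λ n → t ℚ.< ⟦ n ⟧)
          (sym (length-filter≡∑-𝟙 hasSurvivors (allFin q))) (big⇒t< _ isBig)
        child : ∀ {a} → a ∈ branches →
          Σ (Word (suc (size I))) λ z′ → z′ ∈ survivors X (true ∷ I) × pre 1 z′ ≡ pre 0 z ++ [ a ]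
        child a∈ with nonEmpty⇒∈ (proj₂ (∈-filter⁻ (λ a → T? (hasSurvivors a)) {xs = allFin q} a∈))
        ... | w , w∈ = _ , ∈-survivors-true⁺ X I isBig w∈ , refl

      survivors-thick : ∀ {m} (X : List (Word m)) I {z} → z ∈ survivors X I →
        ∀ i → i < size I → ThickAt (survivors X I) z i
      survivors-thick X (false ∷ I) z∈ i i< with ∈-survivors-false⁻ X I z∈
      ... | a , z∈′ = ThickAt-mono (∈-survivors-false⁺ X I) (survivors-thick (residual a X) I z∈′ i i<)
      survivors-thick X (true ∷ I) z∈ i i< with ∈-survivors-true⁻ X I z∈
      survivors-thick X (true ∷ I) {z} z∈ zero _ | isBig , _ = ThickAt-survivors-root X I isBig {z}
      survivors-thick X (true ∷ I) z∈ (suc i) (s≤s i<) | isBig , a , w , w∈ , refl =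
        ThickAt-∷ (∈-survivors-true⁺ X I isBig) (survivors-thick (residual a X) I w∈ i i<)

      isThick⇒PrefixThick : ∀ {m} (X : List (Word m)) I → T (isThick X I) → PrefixThick (size I) (InProj X I) t
      isThick⇒PrefixThick X I thick with nonEmpty⇒∈ thick
      ... | w , w∈ = survivors X I , ∈⇒≢[] w∈ , All.tabulate (survivors⊆proj X I) ,
                     λ i i< z z∈ → survivors-thick X I z∈ i i<
        where
        ∈⇒≢[] : ∀ {xs : List A} {x} → x ∈ xs → xs ≢ []
        ∈⇒≢[] (here _) ()
        ∈⇒≢[] (there _) ()

    branching-positive : ∀ {m} (X : List (Word (suc m))) I → 0 < branching X I →
      Σ (Fin q) λ a → Σ (Word (size I)) λ w → w ∈ survivors (residual a X) I
    branching-positive X I 0<b with ∑-𝟙-positive (allFin q) (λ a → nonEmpty (survivors (residual a X) I)) 0<b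
    ... | a , _ , nonEmpty-survivors with nonEmpty⇒∈ nonEmpty-survivors
    ... | w , w∈ = a , w , w∈

    branching≤q : ∀ {m} (X : List (Word (suc m))) I → branching X I ≤ q
    branching≤q X I = ≤-trans (∑-𝟙≤length (allFin q) (λ a → nonEmpty (survivors (residual a X) I)))
                                (≤-reflexive (length-tabulate (λ a → a)))

    countThick-∷ : ∀ {m} (X : List (Word (suc m))) →
      countThick X ≡ ∑ (subsets m) (λ I → 𝟙 (isThick X (false ∷ I)) + 𝟙 (isThick X (true ∷ I)))
    countThick-∷ {m} X = begin
      countThick X                                                       ≡⟨ ∑-++ (map (false ∷_) (subsets m)) _ _ ⟩
      ∑ (map (false ∷_) (subsets m)) thick + ∑ (map (true ∷_) (subsets m)) thick
                                                                         ≡⟨ cong₂ _+_ (∑-map (false ∷_) (subsets m) thick)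
                                                                                      (∑-map (true ∷_) (subsets m) thick) ⟩
      ∑ (subsets m) (λ I → thick (false ∷ I)) + ∑ (subsets m) (λ I → thick (true ∷ I))
                                                                         ≡⟨ ∑-+ (subsets m) _ _ ⟨
      ∑ (subsets m) (λ I → thick (false ∷ I) + thick (true ∷ I))         ∎
      where
      open ≡-Reasoning
      thick : Vec Bool (suc m) → ℕ
      thick I = 𝟙 (isThick X I)

    ∑-countThick-residual : ∀ {m} (X : List (Word (suc m))) →
      ∑ (allFin q) (λ a → countThick (residual a X)) ≡ ∑ (subsets m) (branching X)
    ∑-countThick-residual {m} X = ∑-swap (allFin q) (subsets m) (λ a I → 𝟙 (isThick (residual a X) I))

    module _ (D K : ℕ) (small : ∀ n → ¬ T (big n) → D * n ≤ K) (bounded : ∀ n → n ≤ q → D * n ≤ 2 * K)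
      where

      weight-bound : ∀ n b₀ b₁ → n ≤ q → (0 < n → T b₀) → (0 < n → T (big n) → T b₁) →
        D * n ≤ (𝟙 b₀ + 𝟙 b₁) * K
      weight-bound zero _ _ _ _ _ = ≤-trans (≤-reflexive (*-zeroʳ D)) z≤n
      weight-bound (suc n) false _ _ thick₀ _ = ⊥-elim (thick₀ (s≤s z≤n))
      weight-bound (suc n) true b₁ n≤q _ thick₁ with T? (big (suc n))
      ... | no ¬big = ≤-trans (small (suc n) ¬big) (m≤m+n K (𝟙 b₁ * K))
      ... | yes isBig with b₁ | thick₁ (s≤s z≤n) isBig
      ...   | true | _ = bounded (suc n) n≤q

      branching-bound : ∀ {m} (X : List (Word (suc m))) I →
        D * branching X I ≤ (𝟙 (isThick X (false ∷ I)) + 𝟙 (isThick X (true ∷ I))) * K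
      branching-bound X I = weight-bound (branching X I) _ _ (branching≤q X I)
        (λ 0<b → let _ , _ , w∈ = branching-positive X I 0<b in ∈⇒nonEmpty (∈-survivors-false⁺ X I w∈))
        (λ 0<b isBig → let _ , _ , w∈ = branching-positive X I 0<b in ∈⇒nonEmpty (∈-survivors-true⁺ X I isBig w∈))

      ∑-branching-bound : ∀ {m} (X : List (Word (suc m))) → D * ∑ (subsets m) (branching X) ≤ countThick X * K
      ∑-branching-bound {m} X = begin
        D * ∑ (subsets m) (branching X)                     ≡⟨ *-∑ D (subsets m) (branching X) ⟩
        ∑ (subsets m) (λ I → D * branching X I)             ≤⟨ ∑-mono-≤ (subsets m) (branching-bound X) ⟩
        ∑ (subsets m) (λ I → (𝟙 (isThick X (false ∷ I)) + 𝟙 (isThick X (true ∷ I))) * K)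
                                                            ≡⟨ ∑-* K (subsets m) _ ⟨
        ∑ (subsets m) (λ I → 𝟙 (isThick X (false ∷ I)) + 𝟙 (isThick X (true ∷ I))) * K
                                                            ≡⟨ cong (_* K) (countThick-∷ X) ⟨
        countThick X * K                                    ∎
        where open ≤-Reasoning

      countThick-bound : ∀ m (X : List (Word m)) → Unique X → D ^ m * length X ≤ countThick X * K ^ m
      countThick-bound zero [] _ = z≤n
      countThick-bound zero ([] ∷ []) _ = s≤s z≤n
      countThick-bound zero ([] ∷ [] ∷ _) ((≢[] ∷ _) ∷ _) = ⊥-elim (≢[] refl)
      countThick-bound (suc m) X uniq = begin
        D * D ^ m * length X                                          ≡⟨ *-assoc D (D ^ m) (length X) ⟩
        D * (D ^ m * length X)                                        ≡⟨ cong (λ n → D * (D ^ m * n)) (length≡∑-residual X) ⟩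
        D * (D ^ m * ∑ (allFin q) (λ a → length (residual a X)))     ≡⟨ cong (D *_) (*-∑ (D ^ m) (allFin q) _) ⟩
        D * ∑ (allFin q) (λ a → D ^ m * length (residual a X))       ≤⟨ *-monoʳ-≤ D (∑-mono-≤ (allFin q) (λ a →
                                                                          countThick-bound m (residual a X) (residual-unique a uniq))) ⟩
        D * ∑ (allFin q) (λ a → countThick (residual a X) * K ^ m)   ≡⟨ cong (D *_) (∑-* (K ^ m) (allFin q) _) ⟨
        D * (∑ (allFin q) (λ a → countThick (residual a X)) * K ^ m) ≡⟨ cong (λ n → D * (n * K ^ m)) (∑-countThick-residual X) ⟩
        D * (∑ (subsets m) (branching X) * K ^ m)                     ≡⟨ *-assoc D _ (K ^ m) ⟨
        D * ∑ (subsets m) (branching X) * K ^ m                       ≤⟨ *-monoˡ-≤ (K ^ m) (∑-branching-bound X) ⟩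
        countThick X * K * K ^ m                                      ≡⟨ *-assoc (countThick X) K (K ^ m) ⟩
        countThick X * (K * K ^ m)                                    ∎
        where open ≤-Reasoning

    thickSubsets : ∀ {m} → List (Word m) → List (Vec Bool m)
    thickSubsets {m} X = filter (λ I → T? (isThick X I)) (subsets m)

    thickSubsets-unique : ∀ {m} (X : List (Word m)) → Unique (thickSubsets X)
    thickSubsets-unique {m} X = Unique.filter⁺ _ (subsets-unique m)

    length-thickSubsets : ∀ {m} (X : List (Word m)) → length (thickSubsets X) ≡ countThick X
    length-thickSubsets {m} X = length-filter≡∑-𝟙 (isThick X) (subsets m)

    thickSubsets-prefixThick : ∀ t → (∀ n → T (big n) → t ℚ.< ⟦ n ⟧) → ∀ {m} (X : List (Word m)) →
      All (λ I → PrefixThick (size I) (InProj X I) t) (thickSubsets X)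
    thickSubsets-prefixThick t big⇒t< {m} X = All.tabulate λ {I} I∈ →
      isThick⇒PrefixThick t big⇒t< X I (proj₂ (∈-filter⁻ (λ I → T? (isThick X I)) {xs = subsets m} I∈))

-- With ε = p / d everything is scaled by D = 2 d to stay in ℕ: n > (½ + ε) q becomes K < D n with
-- K = q (d + 2 p), and ρ = K / D.
module Threshold (q p d-1 : ℕ) (ε : ℚ) (ε*d≡p : ε ℚ.* ⟦ ℕ.suc d-1 ⟧ ≡ ⟦ p ⟧) where

  open import Data.Nat using (suc)
  import Data.Nat.Properties as ℕ
  open import Data.Bool using (T)
  open import Data.Rational using (1ℚ; _+_; _*_; _≤_; _<_; nonNegative; positive)
  open import Data.Rational.Properties
  open import Data.Rational.Solver using (module +-*-Solver)
  open +-*-Solver using (solve; _:+_; _:*_; _:=_; con)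
  open import Algebra.Bundles using (CommutativeRing)
  open import Algebra.Properties.CommutativeSemiring.Exp (CommutativeRing.commutativeSemiring +-*-commutativeRing)
    using (_^_; ^-distrib-*)
  open import Relation.Nullary using (¬_)
  open import Relation.Binary.PropositionalEquality

  d R D K : ℕ
  d = suc d-1
  R = d ℕ.+ 2 ℕ.* p
  D = 2 ℕ.* d
  K = q ℕ.* R

  t : ℚ
  t = (½ + ε) * ⟦ q ⟧

  big : ℕ → Bool
  big n = K ℕ.<ᵇ D ℕ.* n

  ⟦R⟧ : ⟦ R ⟧ ≡ ⟦ d ⟧ * (1ℚ + ⟦ 2 ⟧ * ε)
  ⟦R⟧ = begin
    ⟦ d ℕ.+ 2 ℕ.* p ⟧              ≡⟨ trans (⟦⟧-homo-+ d (2 ℕ.* p)) (cong (λ x → ⟦ d ⟧ + x) (⟦⟧-homo-* 2 p)) ⟩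
    ⟦ d ⟧ + ⟦ 2 ⟧ * ⟦ p ⟧          ≡⟨ cong (λ x → ⟦ d ⟧ + ⟦ 2 ⟧ * x) ε*d≡p ⟨
    ⟦ d ⟧ + ⟦ 2 ⟧ * (ε * ⟦ d ⟧)    ≡⟨ solve 3 (λ d two ε → d :+ two :* (ε :* d) := d :* (con 1ℚ :+ two :* ε))
                                        refl ⟦ d ⟧ ⟦ 2 ⟧ ε ⟩
    ⟦ d ⟧ * (1ℚ + ⟦ 2 ⟧ * ε)       ∎
    where open ≡-Reasoning

  ⟦K⟧ : ⟦ K ⟧ ≡ ⟦ D ⟧ * t
  ⟦K⟧ = begin
    ⟦ q ℕ.* R ⟧                          ≡⟨ trans (⟦⟧-homo-* q R) (cong (⟦ q ⟧ *_) ⟦R⟧) ⟩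
    ⟦ q ⟧ * (⟦ d ⟧ * (1ℚ + ⟦ 2 ⟧ * ε))   ≡⟨ solve 3 (λ q d ε → q :* (d :* (con 1ℚ :+ con ⟦ 2 ⟧ :* ε))
                                              := con ⟦ 2 ⟧ :* d :* ((con ½ :+ ε) :* q)) refl ⟦ q ⟧ ⟦ d ⟧ ε ⟩
    ⟦ 2 ⟧ * ⟦ d ⟧ * t                    ≡⟨ cong (_* t) (⟦⟧-homo-* 2 d) ⟨
    ⟦ D ⟧ * t                            ∎
    where open ≡-Reasoning

  big⇒t< : ∀ n → T (big n) → t < ⟦ n ⟧
  big⇒t< n isBig = *-cancelˡ-<-nonNeg ⟦ D ⟧ {{nonNegative (⟦⟧-nonNeg D)}}
    (subst₂ _<_ ⟦K⟧ (⟦⟧-homo-* D n) (⟦⟧-mono-< (ℕ.<ᵇ⇒< K (D ℕ.* n) isBig)))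

  small : ∀ n → ¬ T (big n) → D ℕ.* n ℕ.≤ K
  small n ¬big = ℕ.≮⇒≥ (λ K<Dn → ¬big (ℕ.<⇒<ᵇ K<Dn))

  bounded : ∀ n → n ℕ.≤ q → D ℕ.* n ℕ.≤ 2 ℕ.* K
  bounded n n≤q = begin
    2 ℕ.* d ℕ.* n    ≡⟨ ℕ.*-assoc 2 d n ⟩
    2 ℕ.* (d ℕ.* n)  ≤⟨ ℕ.*-monoʳ-≤ 2 (begin
      d ℕ.* n          ≤⟨ ℕ.*-monoʳ-≤ d n≤q ⟩
      d ℕ.* q          ≤⟨ ℕ.*-monoˡ-≤ q (ℕ.m≤m+n d (2 ℕ.* p)) ⟩
      R ℕ.* q          ≡⟨ ℕ.*-comm R q ⟩
      K                ∎) ⟩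
    2 ℕ.* K          ∎
    where open ℕ.≤-Reasoning

  rescale : ∀ m a b → D ℕ.^ m ℕ.* a ℕ.≤ b ℕ.* K ℕ.^ m →
    ⟦ a ⟧ * ⟦ 2 ℕ.^ m ⟧ ≤ ⟦ b ⟧ * ⟦ q ℕ.^ m ⟧ * (1ℚ + ⟦ 2 ⟧ * ε) ^ m
  rescale m a b Dᵐa≤bKᵐ =
    *-cancelˡ-≤-pos (⟦ d ⟧ ^ m) {{positive 0<dᵐ}} (subst₂ _≤_ ⟦Dᵐa⟧ ⟦bKᵐ⟧ (⟦⟧-mono-≤ Dᵐa≤bKᵐ))
    where
    open ≡-Reasoning
    r : ℚ
    r = 1ℚ + ⟦ 2 ⟧ * ε
    0<dᵐ : 0ℚ < ⟦ d ⟧ ^ m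
    0<dᵐ = subst (0ℚ <_) (⟦⟧-homo-^ d m) (⟦⟧-mono-< (ℕ.m^n>0 d m))
    ⟦Dᵐa⟧ : ⟦ D ℕ.^ m ℕ.* a ⟧ ≡ ⟦ d ⟧ ^ m * (⟦ a ⟧ * ⟦ 2 ℕ.^ m ⟧)
    ⟦Dᵐa⟧ = begin
      ⟦ D ℕ.^ m ℕ.* a ⟧                ≡⟨ trans (⟦⟧-homo-* (D ℕ.^ m) a) (cong (_* ⟦ a ⟧) (⟦⟧-homo-^ D m)) ⟩
      ⟦ 2 ℕ.* d ⟧ ^ m * ⟦ a ⟧          ≡⟨ cong (λ x → x ^ m * ⟦ a ⟧) (⟦⟧-homo-* 2 d) ⟩
      (⟦ 2 ⟧ * ⟦ d ⟧) ^ m * ⟦ a ⟧      ≡⟨ cong (_* ⟦ a ⟧) (^-distrib-* ⟦ 2 ⟧ ⟦ d ⟧ m) ⟩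
      ⟦ 2 ⟧ ^ m * ⟦ d ⟧ ^ m * ⟦ a ⟧    ≡⟨ solve 3 (λ x y z → x :* y :* z := y :* (z :* x))
                                              refl (⟦ 2 ⟧ ^ m) (⟦ d ⟧ ^ m) ⟦ a ⟧ ⟩
      ⟦ d ⟧ ^ m * (⟦ a ⟧ * ⟦ 2 ⟧ ^ m)  ≡⟨ cong (λ x → ⟦ d ⟧ ^ m * (⟦ a ⟧ * x)) (⟦⟧-homo-^ 2 m) ⟨
      ⟦ d ⟧ ^ m * (⟦ a ⟧ * ⟦ 2 ℕ.^ m ⟧) ∎
    ⟦bKᵐ⟧ : ⟦ b ℕ.* K ℕ.^ m ⟧ ≡ ⟦ d ⟧ ^ m * (⟦ b ⟧ * ⟦ q ℕ.^ m ⟧ * r ^ m)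
    ⟦bKᵐ⟧ = begin
      ⟦ b ℕ.* K ℕ.^ m ⟧                        ≡⟨ trans (⟦⟧-homo-* b (K ℕ.^ m)) (cong (⟦ b ⟧ *_) (⟦⟧-homo-^ K m)) ⟩
      ⟦ b ⟧ * ⟦ q ℕ.* R ⟧ ^ m                  ≡⟨ cong (λ x → ⟦ b ⟧ * x ^ m) (trans (⟦⟧-homo-* q R) (cong (⟦ q ⟧ *_) ⟦R⟧)) ⟩
      ⟦ b ⟧ * (⟦ q ⟧ * (⟦ d ⟧ * r)) ^ m        ≡⟨ cong (⟦ b ⟧ *_) (trans (^-distrib-* ⟦ q ⟧ (⟦ d ⟧ * r) m)
                                                    (cong (⟦ q ⟧ ^ m *_) (^-distrib-* ⟦ d ⟧ r m))) ⟩
      ⟦ b ⟧ * (⟦ q ⟧ ^ m * (⟦ d ⟧ ^ m * r ^ m)) ≡⟨ solve 4 (λ w x y z → w :* (x :* (y :* z)) := y :* (w :* x :* z))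
                                                    refl ⟦ b ⟧ (⟦ q ⟧ ^ m) (⟦ d ⟧ ^ m) (r ^ m) ⟩
      ⟦ d ⟧ ^ m * (⟦ b ⟧ * ⟦ q ⟧ ^ m * r ^ m)   ≡⟨ cong (λ x → ⟦ d ⟧ ^ m * (⟦ b ⟧ * x * r ^ m)) (⟦⟧-homo-^ q m) ⟨
      ⟦ d ⟧ ^ m * (⟦ b ⟧ * ⟦ q ℕ.^ m ⟧ * r ^ m) ∎

lemma5p7 : (q m : ℕ) (𝒳 : List (Vec (Fin q) m)) → Unique 𝒳 →
    (ε : ℚ) → 0ℚ ℚ.≤ ε →
    Σ (List (Vec Bool m)) λ ℱ →
    Unique ℱ ×
    All (λ I → PrefixThick (size I) (InProj 𝒳 I) ((½ ℚ.+ ε) ℚ.* ⟦ q ⟧)) ℱ ×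
    LeTimesExp (⟦ length 𝒳 ⟧ ℚ.* ⟦ 2 ℕ.^ m ⟧) (⟦ length ℱ ⟧ ℚ.* ⟦ q ℕ.^ m ⟧) (⟦ 2 ⟧ ℚ.* ε ℚ.* ⟦ m ⟧)
lemma5p7 q m 𝒳 uniq ε 0≤ε with nonNeg⇒fraction ε 0≤ε
... | p , d-1 , ε*d≡p =
  thickSubsets 𝒳 , thickSubsets-unique 𝒳 , thickSubsets-prefixThick t big⇒t< 𝒳 ,
  ≤*1+^⇒LeTimesExp m (*-nonNeg (⟦⟧-nonNeg (length (thickSubsets 𝒳))) (⟦⟧-nonNeg (q ℕ.^ m)))
    (*-nonNeg (⟦⟧-nonNeg 2) 0≤ε) (rescale m (length 𝒳) (length (thickSubsets 𝒳)) count)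
  where
  open Threshold q p d-1 ε ε*d≡p
  open Pruning big
  count : D ℕ.^ m ℕ.* length 𝒳 ℕ.≤ length (thickSubsets 𝒳) ℕ.* K ℕ.^ m
  count = subst (λ n → D ℕ.^ m ℕ.* length 𝒳 ℕ.≤ n ℕ.* K ℕ.^ m) (sym (length-thickSubsets 𝒳))
    (countThick-bound D K small bounded m 𝒳 uniq)
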